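{- Let $\boldsymbol a\in\mathfrak S_{cc}$ and $X\in[\omega]^\omega_\omega$. If $\sum_X\boldsymbol a$ diverges, then there are a real number $c>0$ and infinitely many pairwise disjoint intervals $I_i\subseteq\omega$ ($i\in\omega$) such that one of the following holds: (1) $\sum_{n\in I_i\setminus X}a_n<-c$ and $c<\sum_{n\in I_i\cap X}a_n$ for all $i\in\omega$; or (2) $\sum_{n\in I_i\cap X}a_n<-c$ and $c<\sum_{n\in I_i\setminus X}a_n$ for all $i\in\omega$.
   Context: Let $\mathfrak S$ be the set of sequences $\boldsymbol a=\langle a_i:i\in\omega\rangle$ of rational numbers with $a_i\to 0$. For infinite $X\subseteq\omega$ with increasing enumeration $\langle i_n:n\in\omega\rangle$, $\sum_X\boldsymbol a$ denotes the series $\sum_{n}a_{i_n}$; it diverges if its partial sums do not converge to a real number. A series is conditionally convergent if it converges to a real number, the sum of its positive terms is $+\infty$ and the sum of its negative terms is $-\infty$. $\mathfrak S_{cc}$ is the set of $\boldsymbol a\in\mathfrak S$ with $\sum_\omega\boldsymbol a$ conditionally convergent; $[\omega]^\omega_\omega$ is the set of infinite coinfinite subsets of $\omega$. -}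

module Defs where

open import Data.Nat using (ℕ; zero; suc; _≤_) renaming (_+_ to _+ℕ_; _<_ to _<ℕ_)
open import Data.Bool using (Bool; true; false; if_then_else_)
open import Data.Rational using (ℚ; 0ℚ; _+_; _-_; -_; _<_; _⊔_; ∣_∣)
open import Data.Product using (Σ; ∃; ∃-syntax; _×_)
open import Relation.Nullary using (¬_)
open import Relation.Binary.PropositionalEquality using (_≡_; _≢_)

Seq : Set
Seq = ℕ → ℚ

Subset : Set
Subset = ℕ → Bool

TendsToZero : Seq → Set
TendsToZero a = ∀ (ε : ℚ) → 0ℚ < ε → ∃[ N ] (∀ n → N ≤ n → ∣ a n ∣ < ε)

psum : Seq → ℕ → ℚ
psum a zero    = 0ℚ
psum a (suc n) = psum a n + a n

-- a sequence of rationals converges to a real number iff it is Cauchy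
CauchyQ : Seq → Set
CauchyQ s = ∀ (ε : ℚ) → 0ℚ < ε →
  ∃[ N ] (∀ m n → N ≤ m → N ≤ n → ∣ s m - s n ∣ < ε)

SeriesConverges : Seq → Set
SeriesConverges a = CauchyQ (psum a)

restrict : Subset → Seq → Seq
restrict X a n = if X n then a n else 0ℚ

restrictCompl : Subset → Seq → Seq
restrictCompl X a n = if X n then 0ℚ else a n

-- For infinite X the partial sums of Σ_X a (along the
-- increasing enumeration of X) converge iff the partial sums of
-- restrict X a do, as the latter are the former with repetitions.
SubseriesConverges : Subset → Seq → Set
SubseriesConverges X a = SeriesConverges (restrict X a)

SubseriesDiverges : Subset → Seq → Set
SubseriesDiverges X a = ¬ SubseriesConverges X a

Unbounded : Seq → Set
Unbounded s = ∀ (M : ℚ) → ∃[ N ] (M < s N)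

posPart : Seq → Seq
posPart a n = a n ⊔ 0ℚ

negPart : Seq → Seq
negPart a n = (- a n) ⊔ 0ℚ

ConditionallyConvergent : Seq → Set
ConditionallyConvergent a =
  SeriesConverges a × Unbounded (psum (posPart a)) × Unbounded (psum (negPart a))

InScc : Seq → Set
InScc a = TendsToZero a × ConditionallyConvergent a

Infinite : Subset → Set
Infinite X = ∀ n → ∃[ m ] (n ≤ m × X m ≡ true)

Coinfinite : Subset → Set
Coinfinite X = ∀ n → ∃[ m ] (n ≤ m × X m ≡ false)

InfCoinf : Subset → Set
InfCoinf X = Infinite X × Coinfinite X

intervalSum : Seq → ℕ → ℕ → ℚ
intervalSum f l len = psum (λ k → f (l +ℕ k)) len

InInterval : ℕ → ℕ → ℕ → Set
InInterval l len n = l ≤ n × n <ℕ l +ℕ len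

PairwiseDisjoint : (ℕ → ℕ) → (ℕ → ℕ) → Set
PairwiseDisjoint l r = ∀ i j → i ≢ j → ∀ n →
  ¬ (InInterval (l i) (r i) n × InInterval (l j) (r j) n)

{-# OPTIONS --safe #-}
-- Write Σ a = Σ_X a + Σ_{ω∖X} a termwise.  Since Σ_X a is not Cauchy, some ε > 0
-- is exceeded by |Σ_{I∩X} a| on intervals I starting arbitrarily late, while
-- convergence of Σ a makes |Σ_I a| < ε/2 on all late intervals.  On such an I the
-- two parts have opposite signs and both exceed ε/2 in absolute value.  One sign
-- pattern occurs on intervals starting arbitrarily late, and these can be chosen
-- one after the other, each starting after the previous one ends.
module Submission where

open import Defs
open import Level using (0ℓ)
open import Axiom.ExcludedMiddle using (ExcludedMiddle)
open import Data.Rational using (ℚ; 0ℚ; -_; _<_)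
open import Data.Product using (_×_; ∃-syntax)
open import Data.Sum using (_⊎_)

open import Axiom.DoubleNegationElimination using (em⇒dne)
open import Data.Bool using (true; false)
open import Data.Nat as ℕ using (ℕ; zero; suc; _≤_; s≤s; z≤n)
import Data.Nat.Properties as ℕ
open import Data.Product using (_,_; ∃; proj₁; proj₂)
open import Data.Rational using (_+_; _-_; _*_; ½; ∣_∣) renaming (_≤_ to _≤ℚ_)
open import Data.Rational.Properties
open import Algebra.Properties.AbelianGroup +-0-abelianGroup
  using () renaming (⁻¹-involutive to neg-involutive)
open import Data.Rational.Solver using (module +-*-Solver)
open import Data.Sum using (inj₁; inj₂) renaming (map to map-⊎)
open import Function using (_∘_)
open import Relation.Binary.Definitions using (tri<; tri≈; tri>)
open import Relation.Binary.PropositionalEquality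
open import Relation.Nullary using (¬_; yes; no; contradiction)

module _ where
  open +-*-Solver

  [p+q]-p≡q : ∀ p q → (p + q) - p ≡ q
  [p+q]-p≡q = solve 2 (λ p q → (p :+ q) :- p := q) refl

  p+-[p+p]≡-p : ∀ p → p + - (p + p) ≡ - p
  p+-[p+p]≡-p = solve 1 (λ p → p :+ :- (p :+ p) := :- p) refl

  p-q≡-[q-p] : ∀ p q → p - q ≡ - (q - p)
  p-q≡-[q-p] = solve 2 (λ p q → p :- q := :- (q :- p)) refl

  p≡p*½+p*½ : ∀ p → p ≡ p * ½ + p * ½
  p≡p*½+p*½ = solve 1 (λ p → p := p :* con ½ :+ p :* con ½) refl

  [p+q]+[r+s]≡[p+r]+[q+s] : ∀ p q r s → (p + q) + (r + s) ≡ (p + r) + (q + s)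
  [p+q]+[r+s]≡[p+r]+[q+s] = solve 4 (λ p q r s → (p :+ q) :+ (r :+ s) := (p :+ r) :+ (q :+ s)) refl

p≤∣p∣ : ∀ p → p ≤ℚ ∣ p ∣
p≤∣p∣ p with ≤-total 0ℚ p
... | inj₁ 0≤p = ≤-reflexive (sym (0≤p⇒∣p∣≡p 0≤p))
... | inj₂ p≤0 = ≤-trans p≤0 (0≤∣p∣ p)

∣p-q∣≡∣q-p∣ : ∀ p q → ∣ p - q ∣ ≡ ∣ q - p ∣
∣p-q∣≡∣q-p∣ p q = trans (cong ∣_∣ (p-q≡-[q-p] p q)) (∣-p∣≡∣p∣ (q - p))

0<p⇒0<p*½ : ∀ {p} → 0ℚ < p → 0ℚ < p * ½
0<p⇒0<p*½ {p} 0<p = subst (_< p * ½) (*-zeroˡ ½) (*-monoˡ-<-pos ½ 0<p)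

split-sign⁺ : ∀ {c x y} → ∣ x + y ∣ < c → c + c ≤ℚ x → y < - c × c < x
split-sign⁺ {c} {x} {y} small c+c≤x = y<-c , <-≤-trans c<c+c c+c≤x
  where
  y<-c : y < - c
  y<-c = subst₂ _<_ ([p+q]-p≡q x y) (p+-[p+p]≡-p c)
    (+-mono-<-≤ (≤-<-trans (p≤∣p∣ (x + y)) small) (neg-antimono-≤ c+c≤x))
  c<c+c : c < c + c
  c<c+c = subst (_< c + c) (+-identityʳ c) (+-monoʳ-< c (≤-<-trans (0≤∣p∣ (x + y)) small))

split-sign : ∀ {c x y} → ∣ x + y ∣ < c → c + c ≤ℚ ∣ x ∣ →
  (y < - c × c < x) ⊎ (x < - c × c < y)
split-sign {c} {x} {y} small large with ∣p∣≡p∨∣p∣≡-p x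
... | inj₁ ∣x∣≡x = inj₁ (split-sign⁺ small (subst (c + c ≤ℚ_) ∣x∣≡x large))
... | inj₂ ∣x∣≡-x = inj₂ (x<-c , c<y)
  where
  -y<-c×c<-x : - y < - c × c < - x
  -y<-c×c<-x = split-sign⁺
    (subst (λ s → ∣ s ∣ < c) (neg-distrib-+ x y) (subst (_< c) (sym (∣-p∣≡∣p∣ (x + y))) small))
    (subst (c + c ≤ℚ_) ∣x∣≡-x large)
  x<-c : x < - c
  x<-c = subst (_< - c) (neg-involutive x) (neg-antimono-< (proj₂ -y<-c×c<-x))
  c<y : c < y
  c<y = subst₂ _<_ (neg-involutive c) (neg-involutive y) (neg-antimono-< (proj₁ -y<-c×c<-x))

psum-+ : ∀ {f g h : Seq} → (∀ n → h n ≡ f n + g n) → ∀ n → psum h n ≡ psum f n + psum g n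
psum-+ h≡f+g zero = sym (+-identityˡ 0ℚ)
psum-+ {f} {g} {h} h≡f+g (suc n) = begin
  psum h n + h n                          ≡⟨ cong₂ _+_ (psum-+ h≡f+g n) (h≡f+g n) ⟩
  (psum f n + psum g n) + (f n + g n)     ≡⟨ [p+q]+[r+s]≡[p+r]+[q+s] (psum f n) (psum g n) (f n) (g n) ⟩
  (psum f n + f n) + (psum g n + g n)     ∎
  where open ≡-Reasoning

intervalSum-+ : ∀ {f g h : Seq} → (∀ n → h n ≡ f n + g n) →
  ∀ l len → intervalSum h l len ≡ intervalSum f l len + intervalSum g l len
intervalSum-+ h≡f+g l = psum-+ (h≡f+g ∘ (l ℕ.+_))

restrict+restrictCompl : ∀ X a n → a n ≡ restrict X a n + restrictCompl X a n
restrict+restrictCompl X a n with X n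
... | true  = sym (+-identityʳ (a n))
... | false = sym (+-identityˡ (a n))

psum-split : ∀ f m k → psum f (m ℕ.+ k) ≡ psum f m + intervalSum f m k
psum-split f m zero rewrite ℕ.+-identityʳ m = sym (+-identityʳ (psum f m))
psum-split f m (suc k) rewrite ℕ.+-suc m k =
  trans (cong (_+ f (m ℕ.+ k)) (psum-split f m k)) (+-assoc (psum f m) _ _)

psum-difference : ∀ f m k → psum f (m ℕ.+ k) - psum f m ≡ intervalSum f m k
psum-difference f m k =
  trans (cong (_- psum f m) (psum-split f m k)) ([p+q]-p≡q (psum f m) (intervalSum f m k))

-- An interval predicate G p k is a property of the interval [p, p + k).
Eventually : (ℕ → ℕ → Set) → Set
Eventually G = ∃[ N ] (∀ p → N ≤ p → ∀ k → G p k)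

Cofinal : (ℕ → ℕ → Set) → Set
Cofinal G = ∀ N → ∃[ p ] ∃[ k ] (N ≤ p × G p k)

CauchyCriterion : Seq → Set
CauchyCriterion f = ∀ ε → 0ℚ < ε → Eventually (λ p k → ∣ intervalSum f p k ∣ < ε)

convergent⇒cauchyCriterion : ∀ {f} → SeriesConverges f → CauchyCriterion f
convergent⇒cauchyCriterion {f} converges ε 0<ε with converges ε 0<ε
... | N , cauchy = N , λ p N≤p k →
  subst (λ s → ∣ s ∣ < ε) (psum-difference f p k)
    (cauchy (p ℕ.+ k) p (ℕ.≤-trans N≤p (ℕ.m≤m+n p k)) N≤p)

cauchyCriterion⇒convergent : ∀ {f} → CauchyCriterion f → SeriesConverges f
cauchyCriterion⇒convergent {f} criterion ε 0<ε with criterion ε 0<ε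
... | N , small = N , close
  where
  close-ordered : ∀ m n → N ≤ n → n ≤ m → ∣ psum f m - psum f n ∣ < ε
  close-ordered m n N≤n n≤m =
    subst (λ m → ∣ psum f m - psum f n ∣ < ε) (ℕ.m+[n∸m]≡n n≤m)
      (subst (λ s → ∣ s ∣ < ε) (sym (psum-difference f n (m ℕ.∸ n))) (small n N≤n (m ℕ.∸ n)))
  close : ∀ m n → N ≤ m → N ≤ n → ∣ psum f m - psum f n ∣ < ε
  close m n N≤m N≤n with ℕ.≤-total m n
  ... | inj₁ m≤n = subst (_< ε) (∣p-q∣≡∣q-p∣ (psum f n) (psum f m)) (close-ordered n m N≤m m≤n)
  ... | inj₂ n≤m = close-ordered m n N≤n n≤m

cofinal-map : ∀ {P Q : ℕ → ℕ → Set} → (∀ p k → P p k → Q p k) → Cofinal P → Cofinal Q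
cofinal-map P⇒Q cofinal N with cofinal N
... | p , k , N≤p , Ppk = p , k , N≤p , P⇒Q p k Ppk

cofinal-∩-eventually : ∀ {P Q : ℕ → ℕ → Set} → Cofinal P → Eventually Q →
  Cofinal (λ p k → P p k × Q p k)
cofinal-∩-eventually cofinal (N₀ , eventually) N with cofinal (N ℕ.⊔ N₀)
... | p , k , N⊔N₀≤p , Ppk =
  p , k , ℕ.m⊔n≤o⇒m≤o N N₀ N⊔N₀≤p , Ppk , eventually p (ℕ.m⊔n≤o⇒n≤o N N₀ N⊔N₀≤p) k

DisjointFamily : (ℕ → ℕ → Set) → Set
DisjointFamily G = ∃[ l ] ∃[ len ] (PairwiseDisjoint l len × ∀ i → G (l i) (len i))

module _ {G : ℕ → ℕ → Set} (cofinal : Cofinal G) where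
  private
    start : ℕ → ℕ
    left : ℕ → ℕ
    len : ℕ → ℕ
    right : ℕ → ℕ

    start zero    = 0
    start (suc i) = right i
    left i = let p , _ = cofinal (start i) in p
    len i = let _ , k , _ = cofinal (start i) in k
    right i = left i ℕ.+ len i

    start≤left : ∀ i → start i ≤ left i
    start≤left i = let _ , _ , start≤p , _ = cofinal (start i) in start≤p

    G-holds : ∀ i → G (left i) (len i)
    G-holds i = let _ , _ , _ , Gpk = cofinal (start i) in Gpk

    right≤start : ∀ i j → i ≤ j → right i ≤ start (suc j)
    right≤start i zero z≤n = ℕ.≤-refl
    right≤start i (suc j) i≤1+j with ℕ.m≤n⇒m<n∨m≡n i≤1+j
    ... | inj₂ refl = ℕ.≤-refl
    ... | inj₁ (s≤s i≤j) = ℕ.≤-trans (right≤start i j i≤j)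
      (ℕ.≤-trans (start≤left (suc j)) (ℕ.m≤m+n (left (suc j)) (len (suc j))))

    right≤left : ∀ {i j} → i ℕ.< j → right i ≤ left j
    right≤left {i} {suc j} (s≤s i≤j) = ℕ.≤-trans (right≤start i j i≤j) (start≤left (suc j))

    separated : ∀ {i j} → i ℕ.< j → ∀ n →
      ¬ (InInterval (left i) (len i) n × InInterval (left j) (len j) n)
    separated i<j n ((_ , n<right) , (left≤n , _)) =
      ℕ.<⇒≱ n<right (ℕ.≤-trans (right≤left i<j) left≤n)

    disjoint : PairwiseDisjoint left len
    disjoint i j i≢j n with ℕ.<-cmp i j
    ... | tri< i<j _ _ = separated i<j n
    ... | tri≈ _ i≡j _ = contradiction i≡j i≢j
    ... | tri> _ _ j<i = λ (inI , inJ) → separated j<i n (inJ , inI)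

  cofinal⇒disjointFamily : DisjointFamily G
  cofinal⇒disjointFamily = left , len , disjoint , G-holds

disjointFamily-⊎ : ∀ {P Q : ℕ → ℕ → Set} → DisjointFamily P ⊎ DisjointFamily Q →
  ∃[ l ] ∃[ len ] (PairwiseDisjoint l len × ((∀ i → P (l i) (len i)) ⊎ (∀ i → Q (l i) (len i))))
disjointFamily-⊎ (inj₁ (l , len , disjoint , P-family)) = l , len , disjoint , inj₁ P-family
disjointFamily-⊎ (inj₂ (l , len , disjoint , Q-family)) = l , len , disjoint , inj₂ Q-family

NegPos : Seq → Seq → ℚ → ℕ → ℕ → Set
NegPos f g c p k = intervalSum f p k < - c × c < intervalSum g p k

module _ (em : ExcludedMiddle 0ℓ) where
  private
    dne : {P : Set} → ¬ ¬ P → P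
    dne = em⇒dne em

  ¬∀⇒∃¬ : ∀ {A : Set} {P : A → Set} → ¬ (∀ x → P x) → ∃ λ x → ¬ P x
  ¬∀⇒∃¬ ¬∀ = dne λ ¬∃ → ¬∀ λ x → dne λ ¬Px → ¬∃ (x , ¬Px)

  ¬→⇒×¬ : ∀ {P Q : Set} → ¬ (P → Q) → P × ¬ Q
  ¬→⇒×¬ ¬P⇒Q = dne (λ ¬P → ¬P⇒Q (λ P → contradiction P ¬P)) , λ Q → ¬P⇒Q (λ _ → Q)

  ¬eventually⇒cofinal¬ : ∀ {G : ℕ → ℕ → Set} → ¬ Eventually G → Cofinal (λ p k → ¬ G p k)
  ¬eventually⇒cofinal¬ ¬eventually N =
    let p , ¬[N≤p⇒G] = ¬∀⇒∃¬ (λ (later : ∀ p → N ≤ p → ∀ k → _) → ¬eventually (N , later))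
        N≤p , ¬∀G = ¬→⇒×¬ ¬[N≤p⇒G]
        k , ¬Gpk = ¬∀⇒∃¬ ¬∀G
    in p , k , N≤p , ¬Gpk

  ¬cauchyCriterion⇒cofinalLarge : ∀ {f} → ¬ CauchyCriterion f →
    ∃[ ε ] (0ℚ < ε × Cofinal (λ p k → ε ≤ℚ ∣ intervalSum f p k ∣))
  ¬cauchyCriterion⇒cofinalLarge ¬criterion =
    let ε , ¬[0<ε⇒eventually] = ¬∀⇒∃¬ ¬criterion
        0<ε , ¬eventually = ¬→⇒×¬ ¬[0<ε⇒eventually]
    in ε , 0<ε , cofinal-map (λ _ _ → ≮⇒≥) (¬eventually⇒cofinal¬ ¬eventually)

  cofinal-⊎ : ∀ {P Q : ℕ → ℕ → Set} → Cofinal (λ p k → P p k ⊎ Q p k) → Cofinal P ⊎ Cofinal Q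
  cofinal-⊎ {P} {Q} cofinal with em {Cofinal P}
  ... | yes cofinalP = inj₁ cofinalP
  ... | no ¬cofinalP = inj₂ cofinalQ
    where
    cofinalQ : Cofinal Q
    cofinalQ N with ¬∀⇒∃¬ ¬cofinalP
    ... | N₀ , noP with cofinal (N ℕ.⊔ N₀)
    ...   | p , k , N⊔N₀≤p , inj₁ Ppk = contradiction (p , k , ℕ.m⊔n≤o⇒n≤o N N₀ N⊔N₀≤p , Ppk) noP
    ...   | p , k , N⊔N₀≤p , inj₂ Qpk = p , k , ℕ.m⊔n≤o⇒m≤o N N₀ N⊔N₀≤p , Qpk

  opposite-blocks : ∀ {f g h : Seq} → (∀ n → h n ≡ f n + g n) →
    SeriesConverges h → ¬ SeriesConverges f →
    ∃[ c ] (0ℚ < c × ∃[ l ] ∃[ len ] (PairwiseDisjoint l len ×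
      ((∀ i → NegPos g f c (l i) (len i)) ⊎ (∀ i → NegPos f g c (l i) (len i)))))
  opposite-blocks {f} {g} {h} h≡f+g h-converges f-diverges
    with ¬cauchyCriterion⇒cofinalLarge {f} (f-diverges ∘ cauchyCriterion⇒convergent {f})
  ... | ε , 0<ε , large =
    c , 0<c , disjointFamily-⊎ {NegPos g f c} {NegPos f g c}
      (map-⊎ cofinal⇒disjointFamily cofinal⇒disjointFamily (cofinal-⊎ blocks))
    where
    c : ℚ
    c = ε * ½
    0<c : 0ℚ < c
    0<c = 0<p⇒0<p*½ 0<ε
    split : ∀ p k → ε ≤ℚ ∣ intervalSum f p k ∣ × ∣ intervalSum h p k ∣ < c →
      NegPos g f c p k ⊎ NegPos f g c p k
    split p k (f-large , h-small) = split-sign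
      (subst (λ s → ∣ s ∣ < c) (intervalSum-+ {f} {g} h≡f+g p k) h-small)
      (subst (_≤ℚ ∣ intervalSum f p k ∣) (p≡p*½+p*½ ε) f-large)
    blocks : Cofinal (λ p k → NegPos g f c p k ⊎ NegPos f g c p k)
    blocks = cofinal-map split
      (cofinal-∩-eventually large (convergent⇒cauchyCriterion h-converges c 0<c))

mainTheorem15 : ExcludedMiddle 0ℓ →
    (a : Seq) (X : Subset) → InScc a → InfCoinf X → SubseriesDiverges X a →
    ∃[ c ] (0ℚ < c × ∃[ l ] ∃[ len ] (PairwiseDisjoint l len ×
      ((∀ i → intervalSum (restrictCompl X a) (l i) (len i) < - c
              × c < intervalSum (restrict X a) (l i) (len i))
       ⊎ (∀ i → intervalSum (restrict X a) (l i) (len i) < - c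
              × c < intervalSum (restrictCompl X a) (l i) (len i)))))
mainTheorem15 em a X (_ , a-converges , _) _ X-diverges =
  opposite-blocks em (restrict+restrictCompl X a) a-converges X-diverges
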